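{- For all $n\ge 0$, $S(n)=SB(2n+1)$.
   Context: For finite words $u,v$ over $\{0,1\}$, $\binom{u}{v}$ denotes the number of occurrences of $v$ as a (scattered) subword (subsequence) of $u$. For $n\ge 1$, $\mathrm{rep}_2(n)$ is the base-$2$ expansion of $n$ with most significant digit first (starting with $1$), and $\mathrm{rep}_2(0)=\varepsilon$. Let $L_2=\{\varepsilon\}\cup 1\{0,1\}^*$ and $S(n)=\#\{v\in L_2 : \binom{\mathrm{rep}_2(n)}{v}>0\}$. The Stern--Brocot sequence $(SB(n))_{n\ge 0}$ is defined by $SB(0)=0$, $SB(1)=1$, and for all $n\ge 1$, $SB(2n)=SB(n)$ and $SB(2n+1)=SB(n)+SB(n+1)$. -}

module Defs where

open import Data.Nat using (ℕ; zero; suc; _+_; _*_; _<ᵇ_; _≡ᵇ_)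
open import Data.Nat.DivMod using (_/_; _%_)
open import Data.Bool using (Bool; true; false; if_then_else_; _∧_)
open import Data.List using (List; []; _∷_; _++_; map; length; filter; concatMap; reverse)
open import Relation.Nullary using (Dec; yes; no)
open import Data.Nat using (_≟_; _<?_)
open import Relation.Binary.PropositionalEquality using (_≡_)

data Bit : Set where
  b0 b1 : Bit

Word : Set
Word = List Bit

bitEq : Bit → Bit → Bool
bitEq b0 b0 = true
bitEq b1 b1 = true
bitEq _  _  = false

-- binom u v : number of occurrences of v as a scattered subword of u
-- (standard recursion: (ua choose vb) = (u choose vb) + [a=b](u choose v), on reversed words;
--  equivalently from the front: (a u choose b v) = (u choose b v) + [a=b] (u choose v))
binom : Word → Word → ℕ
binom u        []       = 1
binom []       (_ ∷ _)  = 0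
binom (a ∷ u)  (b ∷ v)  = binom u (b ∷ v) + (if bitEq a b then binom u v else 0)

repLSB : ℕ → ℕ → Word
repLSB zero       _ = []
repLSB (suc fuel) zero = []
repLSB (suc fuel) (suc m) =
  (if (suc m % 2) ≡ᵇ 0 then b0 else b1) ∷ repLSB fuel (suc m / 2)

rep2 : ℕ → Word
rep2 n = reverse (repLSB n n)

inL2 : Word → Bool
inL2 []        = true
inL2 (b1 ∷ _)  = true
inL2 (b0 ∷ _)  = false

wordsOfLength : ℕ → List Word
wordsOfLength zero    = [] ∷ []
wordsOfLength (suc k) = concatMap (λ w → (b0 ∷ w) ∷ (b1 ∷ w) ∷ []) (wordsOfLength k)

wordsUpTo : ℕ → List Word
wordsUpTo zero    = wordsOfLength zero
wordsUpTo (suc k) = wordsUpTo k ++ wordsOfLength (suc k)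

isPos : ℕ → Bool
isPos zero    = false
isPos (suc _) = true

-- S(n) = #{ v ∈ L_2 : binom (rep2 n) v > 0 }.
-- A word v with binom u v > 0 has length ≤ length u, so it suffices to
-- enumerate words of length ≤ |rep2 n|.
S : ℕ → ℕ
S n = length (Data.List.filter (λ v → Data.Bool._≟_ (inL2 v ∧ isPos (binom (rep2 n) v)) true)
                               (wordsUpTo (length (rep2 n))))

-- Stern–Brocot sequence: SB 0 = 0, SB 1 = 1, SB(2n) = SB n, SB(2n+1) = SB n + SB(n+1);
-- implemented with fuel (fuel ≥ n suffices).
SBf : ℕ → ℕ → ℕ
SBf zero       _ = 0
SBf (suc fuel) zero = 0
SBf (suc fuel) (suc zero) = 1
SBf (suc fuel) (suc (suc m)) =
  if (suc (suc m) % 2) ≡ᵇ 0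
  then SBf fuel (suc (suc m) / 2)
  else SBf fuel (suc (suc m) / 2) + SBf fuel (suc (suc m) / 2 + 1)

SB : ℕ → ℕ
SB n = SBf n n

-- Count the L₂-subwords of u by their last letter: let e₀(u), e₁(u) be the numbers of
-- subwords of u lying in L₂ and ending in 0, resp. 1, so that S = 1 + e₀ + e₁.  A subword
-- of u a ending in a is w a with w a subword of u (w = ε contributes only when a = 1), and
-- the subwords ending in the other letter are those of u.  Hence the pair (e₁, 1 + e₀)
-- evolves under appending a letter exactly like (SB n, SB (n+1)) under n ↦ 2n, 2n+1, so
-- S(n) = SB n + SB (n+1) = SB (2n+1).
module Submission where

open import Defs
open import Data.Bool using (Bool; true; false; if_then_else_; _∧_)
open import Data.Bool.Properties using (∧-identityʳ; ∧-zeroʳ)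
open import Data.List using (List; []; _∷_; _++_; _∷ʳ_; [_]; length; map; filter; concatMap; reverse)
open import Data.List.Properties using (length-++; map-++; map-cong; unfold-reverse)
open import Data.Nat using (ℕ; zero; suc; pred; _+_; _*_; _≤_; _<_; _≡ᵇ_; z≤n; s≤s; s≤s⁻¹; z<s)
open import Data.Nat.DivMod using (_/_; _%_; m*n%n≡0; [m+kn]%n≡m%n; m*n/n≡m; +-distrib-/-∣ʳ)
open import Data.Nat.Divisibility using (divides)
open import Data.Nat.Induction using (<-rec)
open import Data.Nat.ListAction using (sum)
open import Data.Nat.ListAction.Properties using (sum-++)
open import Data.Nat.Properties
open import Algebra.Properties.CommutativeSemigroup +-commutativeSemigroup
  using (interchange; xy∙z≈xz∙y)
open import Data.Product using (_×_; _,_; uncurry)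
open import Function using (_∘_)
open import Relation.Binary.PropositionalEquality hiding ([_])

open ≡-Reasoning

-- Binary recursion

data EvenOdd : ℕ → Set where
  even : ∀ m → EvenOdd (2 * m)
  odd  : ∀ m → EvenOdd (suc (2 * m))

evenOdd : ∀ n → EvenOdd n
evenOdd zero = even 0
evenOdd (suc n) with evenOdd n
... | even m = odd m
... | odd m  = subst EvenOdd (*-suc 2 m) (even (suc m))

1+m<2*[1+m] : ∀ m → suc m < 2 * suc m
1+m<2*[1+m] m = m<m+n (suc m) z<s

m<1+2*m : ∀ m → m < suc (2 * m)
m<1+2*m m = s≤s (m≤m+n m _)

binary-induction : (P : ℕ → Set) → P 0 →
                   (∀ m → P m → P (suc (2 * m))) →
                   (∀ m → P (suc m) → P (2 * suc m)) →
                   ∀ n → P n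
binary-induction P P0 P-odd P-even = <-rec P step
  where
  step : ∀ n → (∀ {m} → m < n → P m) → P n
  step n rec with evenOdd n
  ... | even zero    = P0
  ... | even (suc m) = P-even m (rec (1+m<2*[1+m] m))
  ... | odd m        = P-odd m (rec (m<1+2*m m))

2*m%2≡0 : ∀ m → 2 * m % 2 ≡ 0
2*m%2≡0 m = trans (cong (_% 2) (*-comm 2 m)) (m*n%n≡0 m 2)

[1+2*m]%2≡1 : ∀ m → suc (2 * m) % 2 ≡ 1
[1+2*m]%2≡1 m = trans (cong (_% 2) (cong suc (*-comm 2 m))) ([m+kn]%n≡m%n 1 m 2)

2*m/2≡m : ∀ m → 2 * m / 2 ≡ m
2*m/2≡m m = trans (cong (_/ 2) (*-comm 2 m)) (m*n/n≡m m 2)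

[1+2*m]/2≡m : ∀ m → suc (2 * m) / 2 ≡ m
[1+2*m]/2≡m m = trans (+-distrib-/-∣ʳ 1 (divides m (*-comm 2 m))) (2*m/2≡m m)

-- The Stern–Brocot sequence and the binary expansion

SBf-unfold : ∀ f n → 2 ≤ n →
             SBf (suc f) n ≡ (if n % 2 ≡ᵇ 0 then SBf f (n / 2) else SBf f (n / 2) + SBf f (n / 2 + 1))
SBf-unfold f (suc zero)    (s≤s ())
SBf-unfold f (suc (suc k)) _ = refl

SBf-even : ∀ f m → SBf (suc f) (2 * suc m) ≡ SBf f (suc m)
SBf-even f m
  rewrite SBf-unfold f (2 * suc m) (≤-trans (s≤s (s≤s z≤n)) (1+m<2*[1+m] m))
        | 2*m%2≡0 (suc m) | 2*m/2≡m (suc m) = refl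

SBf-odd : ∀ f m → SBf (suc f) (suc (2 * suc m)) ≡ SBf f (suc m) + SBf f (suc (suc m))
SBf-odd f m rewrite [1+2*m]%2≡1 (suc m) | [1+2*m]/2≡m (suc m) | +-comm (suc m) 1 = refl

SBf-fuel : ∀ {f g} n → n ≤ f → n ≤ g → SBf f n ≡ SBf g n
SBf-fuel {zero}  {zero}  _ z≤n z≤n = refl
SBf-fuel {zero}  {suc g} _ z≤n _   = refl
SBf-fuel {suc f} {zero}  _ _   z≤n = refl
SBf-fuel {suc f} {suc g} n p q with evenOdd n
... | even zero    = refl
... | odd zero     = refl
... | even (suc m) = begin
  SBf (suc f) (2 * suc m) ≡⟨ SBf-even f m ⟩
  SBf f (suc m)           ≡⟨ SBf-fuel (suc m) (half p) (half q) ⟩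
  SBf g (suc m)           ≡⟨ SBf-even g m ⟨
  SBf (suc g) (2 * suc m) ∎
  where
  half : ∀ {h} → 2 * suc m ≤ suc h → suc m ≤ h
  half r = s≤s⁻¹ (<-≤-trans (1+m<2*[1+m] m) r)
... | odd (suc m)  = begin
  SBf (suc f) (suc (2 * suc m))       ≡⟨ SBf-odd f m ⟩
  SBf f (suc m) + SBf f (suc (suc m)) ≡⟨ cong₂ _+_ (SBf-fuel (suc m) (<⇒≤ (half p)) (<⇒≤ (half q)))
                                                   (SBf-fuel (suc (suc m)) (half p) (half q)) ⟩
  SBf g (suc m) + SBf g (suc (suc m)) ≡⟨ SBf-odd g m ⟨
  SBf (suc g) (suc (2 * suc m))       ∎
  where
  half : ∀ {h} → suc (2 * suc m) ≤ suc h → suc (suc m) ≤ h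
  half r = <-≤-trans (1+m<2*[1+m] m) (s≤s⁻¹ r)

SB-even : ∀ m → SB (2 * suc m) ≡ SB (suc m)
SB-even m = trans (SBf-even _ m) (SBf-fuel (suc m) (s≤s⁻¹ (1+m<2*[1+m] m)) ≤-refl)

SB-odd : ∀ m → SB (suc (2 * m)) ≡ SB m + SB (suc m)
SB-odd zero    = refl
SB-odd (suc m) = trans (SBf-odd (2 * suc m) m)
  (cong₂ _+_ (SBf-fuel (suc m) (<⇒≤ (1+m<2*[1+m] m)) ≤-refl)
             (SBf-fuel (suc (suc m)) (1+m<2*[1+m] m) ≤-refl))

repLSB-even : ∀ f m → repLSB (suc f) (2 * suc m) ≡ b0 ∷ repLSB f (suc m)
repLSB-even f m rewrite 2*m%2≡0 (suc m) | 2*m/2≡m (suc m) = refl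

repLSB-odd : ∀ f m → repLSB (suc f) (suc (2 * m)) ≡ b1 ∷ repLSB f m
repLSB-odd f m rewrite [1+2*m]%2≡1 m | [1+2*m]/2≡m m = refl

repLSB-fuel : ∀ {f g} n → n ≤ f → n ≤ g → repLSB f n ≡ repLSB g n
repLSB-fuel {zero}  {zero}  _ z≤n z≤n = refl
repLSB-fuel {zero}  {suc g} _ z≤n _   = refl
repLSB-fuel {suc f} {zero}  _ _   z≤n = refl
repLSB-fuel {suc f} {suc g} n p q with evenOdd n
... | even zero    = refl
... | even (suc m) = begin
  repLSB (suc f) (2 * suc m) ≡⟨ repLSB-even f m ⟩
  b0 ∷ repLSB f (suc m)      ≡⟨ cong (b0 ∷_) (repLSB-fuel (suc m) (half p) (half q)) ⟩
  b0 ∷ repLSB g (suc m)      ≡⟨ repLSB-even g m ⟨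
  repLSB (suc g) (2 * suc m) ∎
  where
  half : ∀ {h} → 2 * suc m ≤ suc h → suc m ≤ h
  half r = s≤s⁻¹ (<-≤-trans (1+m<2*[1+m] m) r)
... | odd m        = begin
  repLSB (suc f) (suc (2 * m)) ≡⟨ repLSB-odd f m ⟩
  b1 ∷ repLSB f m              ≡⟨ cong (b1 ∷_) (repLSB-fuel m (half p) (half q)) ⟩
  b1 ∷ repLSB g m              ≡⟨ repLSB-odd g m ⟨
  repLSB (suc g) (suc (2 * m)) ∎
  where
  half : ∀ {h} → suc (2 * m) ≤ suc h → m ≤ h
  half r = s≤s⁻¹ (<-≤-trans (m<1+2*m m) r)

rep2-odd : ∀ m → rep2 (suc (2 * m)) ≡ rep2 m ∷ʳ b1
rep2-odd m = begin
  reverse (repLSB (suc (2 * m)) (suc (2 * m))) ≡⟨ cong reverse (repLSB-odd (2 * m) m) ⟩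
  reverse (b1 ∷ repLSB (2 * m) m)              ≡⟨ unfold-reverse b1 (repLSB (2 * m) m) ⟩
  reverse (repLSB (2 * m) m) ∷ʳ b1             ≡⟨ cong (λ w → reverse w ∷ʳ b1)
                                                       (repLSB-fuel m (m≤m+n m _) ≤-refl) ⟩
  rep2 m ∷ʳ b1                                 ∎

rep2-even : ∀ m → rep2 (2 * suc m) ≡ rep2 (suc m) ∷ʳ b0
rep2-even m = begin
  reverse (repLSB (suc f) (2 * suc m)) ≡⟨ cong reverse (repLSB-even f m) ⟩
  reverse (b0 ∷ repLSB f (suc m))      ≡⟨ unfold-reverse b0 (repLSB f (suc m)) ⟩
  reverse (repLSB f (suc m)) ∷ʳ b0     ≡⟨ cong (λ w → reverse w ∷ʳ b0)
                                               (repLSB-fuel (suc m) (s≤s⁻¹ (1+m<2*[1+m] m)) ≤-refl) ⟩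
  rep2 (suc m) ∷ʳ b0                   ∎
  where
  f = pred (2 * suc m)

-- Subwords

if-then-0-+ : ∀ p x y → (if p then x + y else 0) ≡ (if p then x else 0) + (if p then y else 0)
if-then-0-+ true  x y = refl
if-then-0-+ false x y = refl

if-then-0-comm : ∀ p q x → (if p then (if q then x else 0) else 0) ≡ (if q then (if p then x else 0) else 0)
if-then-0-comm true  q x = refl
if-then-0-comm false true  x = refl
if-then-0-comm false false x = refl

if-then-0-0 : ∀ p → (if p then 0 else 0) ≡ 0
if-then-0-0 true  = refl
if-then-0-0 false = refl

bitEq-refl : ∀ a → bitEq a a ≡ true
bitEq-refl b0 = refl
bitEq-refl b1 = refl

binom-too-long : ∀ u v → length u < length v → binom u v ≡ 0
binom-too-long []      (_ ∷ _) _       = refl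
binom-too-long (a ∷ u) (c ∷ v) (s≤s p) =
  cong₂ _+_ (binom-too-long u (c ∷ v) (m≤n⇒m≤1+n p))
            (trans (cong (λ x → if bitEq a c then x else 0) (binom-too-long u v p)) (if-then-0-0 (bitEq a c)))

binom-[]-∷ʳ : ∀ v b → binom [] (v ∷ʳ b) ≡ 0
binom-[]-∷ʳ []      b = refl
binom-[]-∷ʳ (_ ∷ _) b = refl

binom-∷ʳ-∷ʳ : ∀ u v a b →
              binom (u ∷ʳ a) (v ∷ʳ b) ≡ binom u (v ∷ʳ b) + (if bitEq a b then binom u v else 0)
binom-∷ʳ-∷ʳ []      []      a b = refl
binom-∷ʳ-∷ʳ []      (d ∷ v) a b rewrite binom-[]-∷ʳ v b =
  trans (if-then-0-0 (bitEq a d)) (sym (if-then-0-0 (bitEq a b)))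
binom-∷ʳ-∷ʳ (c ∷ u) []      a b rewrite binom-∷ʳ-∷ʳ u [] a b =
  xy∙z≈xz∙y (binom u [ b ]) _ _
binom-∷ʳ-∷ʳ (c ∷ u) (d ∷ v) a b rewrite binom-∷ʳ-∷ʳ u (d ∷ v) a b | binom-∷ʳ-∷ʳ u v a b = begin
  (x + δ y) + ε (z + δ w)     ≡⟨ cong ((x + δ y) +_) (if-then-0-+ (bitEq c d) z (δ w)) ⟩
  (x + δ y) + (ε z + ε (δ w)) ≡⟨ interchange x (δ y) (ε z) (ε (δ w)) ⟩
  (x + ε z) + (δ y + ε (δ w)) ≡⟨ cong (λ t → (x + ε z) + (δ y + t)) (if-then-0-comm (bitEq c d) (bitEq a b) w) ⟩
  (x + ε z) + (δ y + δ (ε w)) ≡⟨ cong ((x + ε z) +_) (if-then-0-+ (bitEq a b) y (ε w)) ⟨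
  (x + ε z) + δ (y + ε w)     ∎
  where
  δ ε : ℕ → ℕ
  δ t = if bitEq a b then t else 0
  ε t = if bitEq c d then t else 0
  x = binom u ((d ∷ v) ∷ʳ b)
  y = binom u (d ∷ v)
  z = binom u (v ∷ʳ b)
  w = binom u v

binom-∷ʳ-vanish : ∀ u v b → binom u v ≡ 0 → binom u (v ∷ʳ b) ≡ 0
binom-∷ʳ-vanish []      (_ ∷ _) b _ = refl
binom-∷ʳ-vanish (a ∷ u) (c ∷ v) b e with bitEq a c
... | true  = cong₂ _+_ (binom-∷ʳ-vanish u (c ∷ v) b (m+n≡0⇒m≡0 _ e))
                        (binom-∷ʳ-vanish u v b (m+n≡0⇒n≡0 (binom u (c ∷ v)) e))
... | false = cong (_+ 0) (binom-∷ʳ-vanish u (c ∷ v) b (trans (sym (+-identityʳ _)) e))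

infix 7 _⊑?_

_⊑?_ : Word → Word → Bool
v ⊑? u = isPos (binom u v)

isPos-+ : ∀ x y → (y ≡ 0 → x ≡ 0) → isPos (x + y) ≡ isPos y
isPos-+ x zero    y≡0⇒x≡0 rewrite y≡0⇒x≡0 refl = refl
isPos-+ x (suc y) _       rewrite +-suc x y = refl

∷ʳ-⊑?-∷ʳ : ∀ u v a → ((v ∷ʳ a) ⊑? (u ∷ʳ a)) ≡ (v ⊑? u)
∷ʳ-⊑?-∷ʳ u v a rewrite binom-∷ʳ-∷ʳ u v a a | bitEq-refl a =
  isPos-+ (binom u (v ∷ʳ a)) (binom u v) (binom-∷ʳ-vanish u v a)

∷ʳ-⊑?-∷ʳ-≢ : ∀ u v a b → bitEq a b ≡ false → ((v ∷ʳ b) ⊑? (u ∷ʳ a)) ≡ ((v ∷ʳ b) ⊑? u)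
∷ʳ-⊑?-∷ʳ-≢ u v a b a≢b rewrite binom-∷ʳ-∷ʳ u v a b | a≢b = cong isPos (+-identityʳ _)

inL2-∷ʳ : ∀ w b a → inL2 ((w ∷ʳ b) ∷ʳ a) ≡ inL2 (w ∷ʳ b)
inL2-∷ʳ []       b0 a = refl
inL2-∷ʳ []       b1 a = refl
inL2-∷ʳ (b0 ∷ w) b  a = refl
inL2-∷ʳ (b1 ∷ w) b  a = refl

-- Counting words

length-∷ʳ : ∀ {A : Set} (xs : List A) x → length (xs ∷ʳ x) ≡ suc (length xs)
length-∷ʳ xs x = trans (length-++ xs) (+-comm (length xs) 1)

χ : Bool → ℕ
χ true  = 1
χ false = 0

∑ : ∀ {A : Set} → List A → (A → ℕ) → ℕ
∑ xs f = sum (map f xs)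

∑-++ : ∀ {A : Set} (xs ys : List A) f → ∑ (xs ++ ys) f ≡ ∑ xs f + ∑ ys f
∑-++ xs ys f = trans (cong sum (map-++ f xs ys)) (sum-++ (map f xs) (map f ys))

∑-cong : ∀ {A : Set} (xs : List A) {f g} → (∀ x → f x ≡ g x) → ∑ xs f ≡ ∑ xs g
∑-cong xs f≗g = cong sum (map-cong f≗g xs)

length-filter≡∑χ : ∀ {A : Set} (p : A → Bool) xs →
                   length (filter (λ x → Data.Bool._≟_ (p x) true) xs) ≡ ∑ xs (χ ∘ p)
length-filter≡∑χ p []       = refl
length-filter≡∑χ p (x ∷ xs) with p x
... | true  = cong suc (length-filter≡∑χ p xs)
... | false = length-filter≡∑χ p xs

wordsShorterThan : ℕ → List Word
wordsShorterThan zero    = []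
wordsShorterThan (suc k) = wordsUpTo k

wordsUpTo-split : ∀ k → wordsUpTo k ≡ wordsShorterThan k ++ wordsOfLength k
wordsUpTo-split zero    = refl
wordsUpTo-split (suc k) = refl

∑-wordsOfLength-∷ : ∀ k f → ∑ (wordsOfLength (suc k)) f ≡
                    ∑ (wordsOfLength k) (f ∘ (b0 ∷_)) + ∑ (wordsOfLength k) (f ∘ (b1 ∷_))
∑-wordsOfLength-∷ k f = go (wordsOfLength k)
  where
  f₀ f₁ : Word → ℕ
  f₀ = f ∘ (b0 ∷_)
  f₁ = f ∘ (b1 ∷_)
  go : ∀ ws → ∑ (concatMap (λ w → (b0 ∷ w) ∷ (b1 ∷ w) ∷ []) ws) f ≡ ∑ ws f₀ + ∑ ws f₁
  go []       = refl
  go (w ∷ ws) = begin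
    f₀ w + (f₁ w + ∑ (concatMap _ ws) f) ≡⟨ cong (λ t → f₀ w + (f₁ w + t)) (go ws) ⟩
    f₀ w + (f₁ w + (∑ ws f₀ + ∑ ws f₁))  ≡⟨ +-assoc (f₀ w) (f₁ w) _ ⟨
    (f₀ w + f₁ w) + (∑ ws f₀ + ∑ ws f₁)  ≡⟨ interchange (f₀ w) (f₁ w) (∑ ws f₀) (∑ ws f₁) ⟩
    (f₀ w + ∑ ws f₀) + (f₁ w + ∑ ws f₁)  ∎

∑-wordsOfLength-∷ʳ : ∀ k f → ∑ (wordsOfLength (suc k)) f ≡
                     ∑ (wordsOfLength k) (f ∘ (_∷ʳ b0)) + ∑ (wordsOfLength k) (f ∘ (_∷ʳ b1))
∑-wordsOfLength-∷ʳ zero    f = ∑-wordsOfLength-∷ zero f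
∑-wordsOfLength-∷ʳ (suc k) f = begin
  ∑ (wordsOfLength (suc (suc k))) f                         ≡⟨ ∑-wordsOfLength-∷ (suc k) f ⟩
  ∑ W (f ∘ (b0 ∷_)) + ∑ W (f ∘ (b1 ∷_))                     ≡⟨ cong₂ _+_ (∑-wordsOfLength-∷ʳ k (f ∘ (b0 ∷_)))
                                                                         (∑-wordsOfLength-∷ʳ k (f ∘ (b1 ∷_))) ⟩
  (∑ V (f ∘ ⟨ b0 , b0 ⟩) + ∑ V (f ∘ ⟨ b0 , b1 ⟩)) +
  (∑ V (f ∘ ⟨ b1 , b0 ⟩) + ∑ V (f ∘ ⟨ b1 , b1 ⟩))           ≡⟨ interchange (∑ V (f ∘ ⟨ b0 , b0 ⟩)) _ _ (∑ V (f ∘ ⟨ b1 , b1 ⟩)) ⟩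
  (∑ V (f ∘ ⟨ b0 , b0 ⟩) + ∑ V (f ∘ ⟨ b1 , b0 ⟩)) +
  (∑ V (f ∘ ⟨ b0 , b1 ⟩) + ∑ V (f ∘ ⟨ b1 , b1 ⟩))           ≡⟨ cong₂ _+_ (∑-wordsOfLength-∷ k (f ∘ (_∷ʳ b0)))
                                                                         (∑-wordsOfLength-∷ k (f ∘ (_∷ʳ b1))) ⟨
  ∑ W (f ∘ (_∷ʳ b0)) + ∑ W (f ∘ (_∷ʳ b1))                   ∎
  where
  V = wordsOfLength k
  W = wordsOfLength (suc k)
  ⟨_,_⟩ : Bit → Bit → Word → Word
  ⟨ a , b ⟩ w = a ∷ w ∷ʳ b

∑-wordsOfLength-vanish : ∀ k f → (∀ w → length w ≡ k → f w ≡ 0) → ∑ (wordsOfLength k) f ≡ 0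
∑-wordsOfLength-vanish zero    f f≡0 = cong (_+ 0) (f≡0 [] refl)
∑-wordsOfLength-vanish (suc k) f f≡0 = trans (∑-wordsOfLength-∷ k f)
  (cong₂ _+_ (∑-wordsOfLength-vanish k _ (λ w e → f≡0 (b0 ∷ w) (cong suc e)))
             (∑-wordsOfLength-vanish k _ (λ w e → f≡0 (b1 ∷ w) (cong suc e))))

∑-wordsUpTo-∷ʳ : ∀ k f → ∑ (wordsUpTo k) f ≡
                 f [] + (∑ (wordsShorterThan k) (f ∘ (_∷ʳ b0)) + ∑ (wordsShorterThan k) (f ∘ (_∷ʳ b1)))
∑-wordsUpTo-∷ʳ zero    f = refl
∑-wordsUpTo-∷ʳ (suc k) f = begin
  ∑ (wordsUpTo k ++ wordsOfLength (suc k)) f              ≡⟨ ∑-++ (wordsUpTo k) _ f ⟩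
  ∑ (wordsUpTo k) f + ∑ (wordsOfLength (suc k)) f         ≡⟨ cong₂ _+_ (∑-wordsUpTo-∷ʳ k f) (∑-wordsOfLength-∷ʳ k f) ⟩
  (f [] + (∑ V f₀ + ∑ V f₁)) + (∑ W f₀ + ∑ W f₁)          ≡⟨ +-assoc (f []) (∑ V f₀ + ∑ V f₁) _ ⟩
  f [] + ((∑ V f₀ + ∑ V f₁) + (∑ W f₀ + ∑ W f₁))          ≡⟨ cong (f [] +_) (interchange (∑ V f₀) (∑ V f₁) (∑ W f₀) (∑ W f₁)) ⟩
  f [] + ((∑ V f₀ + ∑ W f₀) + (∑ V f₁ + ∑ W f₁))          ≡⟨ cong (f [] +_) (cong₂ _+_ (∑-++ V W f₀) (∑-++ V W f₁)) ⟨
  f [] + (∑ (V ++ W) f₀ + ∑ (V ++ W) f₁)                  ≡⟨ cong (λ U → f [] + (∑ U f₀ + ∑ U f₁)) (wordsUpTo-split k) ⟨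
  f [] + (∑ (wordsUpTo k) f₀ + ∑ (wordsUpTo k) f₁)        ∎
  where
  V = wordsShorterThan k
  W = wordsOfLength k
  f₀ f₁ : Word → ℕ
  f₀ = f ∘ (_∷ʳ b0)
  f₁ = f ∘ (_∷ʳ b1)

-- L₂-subwords by their last letter

#L2-subwords : Word → ℕ → ℕ
#L2-subwords u N = ∑ (wordsUpTo N) (λ v → χ (inL2 v ∧ v ⊑? u))

#L2-subwords-ending : Bit → Word → ℕ → ℕ
#L2-subwords-ending a u N = ∑ (wordsShorterThan N) (λ w → χ (inL2 (w ∷ʳ a) ∧ (w ∷ʳ a) ⊑? u))

#L2-subwords-split : ∀ u N →
                     #L2-subwords u N ≡ suc (#L2-subwords-ending b0 u N + #L2-subwords-ending b1 u N)
#L2-subwords-split u N = ∑-wordsUpTo-∷ʳ N (λ v → χ (inL2 v ∧ v ⊑? u))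

#L2-subwords-ending-∷ʳ : ∀ a u N → #L2-subwords-ending a (u ∷ʳ a) (suc N) ≡
                         χ (inL2 [ a ]) + (#L2-subwords-ending b0 u N + #L2-subwords-ending b1 u N)
#L2-subwords-ending-∷ʳ a u N = trans (∑-wordsUpTo-∷ʳ N g)
  (cong₂ _+_ g[] (cong₂ _+_ (∑-cong (wordsShorterThan N) (g-∷ʳ b0)) (∑-cong (wordsShorterThan N) (g-∷ʳ b1))))
  where
  g : Word → ℕ
  g w = χ (inL2 (w ∷ʳ a) ∧ (w ∷ʳ a) ⊑? (u ∷ʳ a))
  g[] : g [] ≡ χ (inL2 [ a ])
  g[] = cong χ (trans (cong (inL2 [ a ] ∧_) (∷ʳ-⊑?-∷ʳ u [] a)) (∧-identityʳ _))
  g-∷ʳ : ∀ b w → g (w ∷ʳ b) ≡ χ (inL2 (w ∷ʳ b) ∧ (w ∷ʳ b) ⊑? u)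
  g-∷ʳ b w = cong₂ (λ p q → χ (p ∧ q)) (inL2-∷ʳ w b a) (∷ʳ-⊑?-∷ʳ u (w ∷ʳ b) a)

#L2-subwords-ending-∷ʳ-≢ : ∀ a b u N → bitEq a b ≡ false →
                           #L2-subwords-ending b (u ∷ʳ a) N ≡ #L2-subwords-ending b u N
#L2-subwords-ending-∷ʳ-≢ a b u N a≢b = ∑-cong (wordsShorterThan N)
  (λ w → cong (λ q → χ (inL2 (w ∷ʳ b) ∧ q)) (∷ʳ-⊑?-∷ʳ-≢ u w a b a≢b))

#L2-subwords-ending-stable : ∀ b u N → length u ≤ N →
                             #L2-subwords-ending b u (suc N) ≡ #L2-subwords-ending b u N
#L2-subwords-ending-stable b u N |u|≤N = begin
  ∑ (wordsUpTo N) h                                ≡⟨ cong (λ U → ∑ U h) (wordsUpTo-split N) ⟩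
  ∑ (wordsShorterThan N ++ wordsOfLength N) h      ≡⟨ ∑-++ (wordsShorterThan N) (wordsOfLength N) h ⟩
  ∑ (wordsShorterThan N) h + ∑ (wordsOfLength N) h ≡⟨ cong (∑ (wordsShorterThan N) h +_) (∑-wordsOfLength-vanish N h too-long) ⟩
  ∑ (wordsShorterThan N) h + 0                     ≡⟨ +-identityʳ _ ⟩
  ∑ (wordsShorterThan N) h                         ∎
  where
  h : Word → ℕ
  h w = χ (inL2 (w ∷ʳ b) ∧ (w ∷ʳ b) ⊑? u)
  too-long : ∀ w → length w ≡ N → h w ≡ 0
  too-long w |w|≡N rewrite binom-too-long u (w ∷ʳ b)
    (subst (length u <_) (sym (trans (length-∷ʳ w b) (cong suc |w|≡N))) (s≤s |u|≤N)) =
    cong χ (∧-zeroʳ _)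

sternBrocotStep : Bit → ℕ × ℕ → ℕ × ℕ
sternBrocotStep b0 (x , y) = x , x + y
sternBrocotStep b1 (x , y) = x + y , y

SB-pair : ℕ → ℕ × ℕ
SB-pair n = SB n , SB (suc n)

SB-pair-odd : ∀ m → SB-pair (suc (2 * m)) ≡ sternBrocotStep b1 (SB-pair m)
SB-pair-odd m = cong₂ _,_ (SB-odd m) (trans (cong SB (sym (*-suc 2 m))) (SB-even m))

SB-pair-even : ∀ m → SB-pair (2 * suc m) ≡ sternBrocotStep b0 (SB-pair (suc m))
SB-pair-even m = cong₂ _,_ (SB-even m) (SB-odd (suc m))

endingCounts : Word → ℕ × ℕ
endingCounts u = #L2-subwords-ending b1 u (length u) , suc (#L2-subwords-ending b0 u (length u))

endingCounts-∷ʳ : ∀ u a → endingCounts (u ∷ʳ a) ≡ sternBrocotStep a (endingCounts u)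
endingCounts-∷ʳ u a =
  trans (cong (λ N → #L2-subwords-ending b1 (u ∷ʳ a) N , suc (#L2-subwords-ending b0 (u ∷ʳ a) N))
              (length-∷ʳ u a))
        (step a)
  where
  L = length u
  e₀ = #L2-subwords-ending b0 u L
  e₁ = #L2-subwords-ending b1 u L
  other : ∀ a b → bitEq a b ≡ false → #L2-subwords-ending b (u ∷ʳ a) (suc L) ≡ #L2-subwords-ending b u L
  other a b a≢b = trans (#L2-subwords-ending-∷ʳ-≢ a b u (suc L) a≢b) (#L2-subwords-ending-stable b u L ≤-refl)
  step : ∀ a → (#L2-subwords-ending b1 (u ∷ʳ a) (suc L) , suc (#L2-subwords-ending b0 (u ∷ʳ a) (suc L)))
               ≡ sternBrocotStep a (e₁ , suc e₀)
  step b0 = cong₂ _,_ (other b0 b1 refl) (trans (cong suc (#L2-subwords-ending-∷ʳ b0 u L)) (+-comm (suc e₀) e₁))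
  step b1 = cong₂ _,_ (trans (#L2-subwords-ending-∷ʳ b1 u L) (+-comm (suc e₀) e₁)) (cong suc (other b1 b0 refl))

endingCounts-rep2 : ∀ n → endingCounts (rep2 n) ≡ SB-pair n
endingCounts-rep2 = binary-induction (λ n → endingCounts (rep2 n) ≡ SB-pair n) refl
  (λ m → append (suc (2 * m)) m b1 (rep2-odd m) (SB-pair-odd m))
  (λ m → append (2 * suc m) (suc m) b0 (rep2-even m) (SB-pair-even m))
  where
  append : ∀ n m a → rep2 n ≡ rep2 m ∷ʳ a → SB-pair n ≡ sternBrocotStep a (SB-pair m) →
           endingCounts (rep2 m) ≡ SB-pair m → endingCounts (rep2 n) ≡ SB-pair n
  append n m a rep2-n SB-n ih = begin
    endingCounts (rep2 n)                     ≡⟨ cong endingCounts rep2-n ⟩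
    endingCounts (rep2 m ∷ʳ a)                ≡⟨ endingCounts-∷ʳ (rep2 m) a ⟩
    sternBrocotStep a (endingCounts (rep2 m)) ≡⟨ cong (sternBrocotStep a) ih ⟩
    sternBrocotStep a (SB-pair m)             ≡⟨ SB-n ⟨
    SB-pair n                                 ∎

#L2-subwords≡endingCounts : ∀ u → #L2-subwords u (length u) ≡ uncurry _+_ (endingCounts u)
#L2-subwords≡endingCounts u = trans (#L2-subwords-split u (length u)) (+-comm (suc e₀) _)
  where
  e₀ = #L2-subwords-ending b0 u (length u)

mainTheorem2 : (n : ℕ) → S n ≡ SB (2 * n + 1)
mainTheorem2 n = begin
  S n                                     ≡⟨ length-filter≡∑χ (λ v → inL2 v ∧ v ⊑? rep2 n)
                                                              (wordsUpTo (length (rep2 n))) ⟩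
  #L2-subwords (rep2 n) (length (rep2 n)) ≡⟨ #L2-subwords≡endingCounts (rep2 n) ⟩
  uncurry _+_ (endingCounts (rep2 n))     ≡⟨ cong (uncurry _+_) (endingCounts-rep2 n) ⟩
  SB n + SB (suc n)                       ≡⟨ SB-odd n ⟨
  SB (suc (2 * n))                        ≡⟨ cong SB (+-comm 1 (2 * n)) ⟩
  SB (2 * n + 1)                          ∎
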